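{- Let $t$, $M$, $N$ be parameters with $M\ge N^{4t}/4^t$ (and $M>(t-1)N$). Then $t\text{ - }\mathrm{PIGEON}^M_N$ can be black-box reduced to $\mathrm{RAMSEY}$ and to its bipartite variant $\mathrm{BIRAMSEY}$.
   Context: $t\text{ - }\mathrm{PIGEON}^M_N$: given a map $h:[M]\to[N]$ of $M$ pigeons to $N$ holes (in the black-box setting given by an oracle/input bits encoding $h$ in binary), find a $t$-collision, i.e., a set of $t$ distinct pigeons all mapped by $h$ to the same hole. $\mathrm{RAMSEY}$: given $C:\{0,1\}^k\times\{0,1\}^k\to\{0,1\}$ encoding a graph on $2^k$ vertices, output either $u$ with $C(u,u)=1$, or $u,v$ with $C(u,v)\neq C(v,u)$, or a set of $k/2$ vertices forming a clique or an independent set. $\mathrm{BIRAMSEY}$: given $C:\{0,1\}^k\times\{0,1\}^k\to\{0,1\}$ encoding a bipartite graph with $2^k$ vertices on each side, output sets $U,V$ of $k/2$ vertices on the two sides forming either a biclique or an independent set. A black-box reduction is a decision-tree reduction (depth-$d$ decision trees computing each input bit of the target instance from the source input, and depth-$d$ decision trees mapping each target solution back to a source solution which must be valid whenever the target solution is valid) of complexity $d+\log(\text{target input length})=\mathrm{poly}(\log(\text{source input length}))$. -}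

module Defs where

open import Data.Nat using (ℕ; zero; suc; _+_; _*_; _^_; _≤_; _<_; _⊔_)
open import Data.Nat.DivMod using (_/_)
open import Data.Nat.Logarithm using (⌈log₂_⌉)
open import Data.Fin using (Fin)
open import Data.Bool using (Bool; true; false)
open import Data.Product using (Σ; _×_; ∃)
open import Data.Sum using (_⊎_)
open import Relation.Binary.PropositionalEquality using (_≡_; _≢_)
open import Function.Definitions using (Injective)

-- Decision trees over the black-box source instance h : [M] → [N].
-- A query asks for h(i) (i.e. the ⌈log₂ N⌉ bits encoding h(i)).

data DT (M N : ℕ) (A : Set) : Set where
  leaf  : A → DT M N A
  query : Fin M → (Fin N → DT M N A) → DT M N A

maxF : (n : ℕ) → (Fin n → ℕ) → ℕ
maxF zero    f = 0
maxF (suc n) f = f Fin.zero ⊔ maxF n (λ i → f (Fin.suc i))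

-- depth counted in pigeon-queries
depth : ∀ {M N A} → DT M N A → ℕ
depth (leaf a)    = 0
depth {N = N} (query i f) = suc (maxF N (λ j → depth (f j)))

eval : ∀ {M N A} → DT M N A → (Fin M → Fin N) → A
eval (leaf a)    h = a
eval (query i f) h = eval (f (h i)) h

IsCollision : (t M N : ℕ) → (Fin M → Fin N) → (Fin t → Fin M) → Set
IsCollision t M N h p = Injective _≡_ _≡_ p × (∀ i j → h (p i) ≡ h (p j))

-- RAMSEY with parameter k : vertices {0,1}^k ≅ Fin (2 ^ k).

Vtx : ℕ → Set
Vtx k = Fin (2 ^ k)

data RSol (k : ℕ) : Set where
  loop  : Vtx k → RSol k
  asym  : Vtx k → Vtx k → RSol k
  homog : (Fin (k / 2) → Vtx k) → RSol k

RValid : (k : ℕ) → (Vtx k → Vtx k → Bool) → RSol k → Set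
RValid k C (loop u)   = C u u ≡ true
RValid k C (asym u v) = C u v ≢ C v u
RValid k C (homog S)  =
  Injective _≡_ _≡_ S ×
  ((∀ i j → i ≢ j → C (S i) (S j) ≡ true) ⊎
   (∀ i j → i ≢ j → C (S i) (S j) ≡ false))

record BSol (k : ℕ) : Set where
  constructor bsol
  field
    U : Fin (k / 2) → Vtx k
    V : Fin (k / 2) → Vtx k

BValid : (k : ℕ) → (Vtx k → Vtx k → Bool) → BSol k → Set
BValid k C (bsol U V) =
  Injective _≡_ _≡_ U × Injective _≡_ _≡_ V ×
  ((∀ i j → C (U i) (V j) ≡ true) ⊎ (∀ i j → C (U i) (V j) ≡ false))

-- Source input length: M pigeons, each hole written with ⌈log₂ N⌉ bits.
-- Bit-query depth of a tree with d pigeon-queries: d * ⌈log₂ N⌉.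
-- Target input length of RAMSEY/BIRAMSEY with parameter k: 2^(2k) bits,
-- so log(target input length) = 2k.

srcLen : ℕ → ℕ → ℕ
srcLen M N = M * ⌈log₂ N ⌉

-- "poly(log(source length))" with exponent/constant c
polylogBound : ℕ → ℕ → ℕ → ℕ
polylogBound c M N = c * (1 + ⌈log₂ srcLen M N ⌉) ^ c

record RamseyRed (c t M N : ℕ) : Set where
  field
    k     : ℕ
    d     : ℕ
    inst  : Vtx k → Vtx k → DT M N Bool
    back  : RSol k → DT M N (Fin t → Fin M)
    inst-depth : ∀ u v → depth (inst u v) ≤ d
    back-depth : ∀ s → depth (back s) ≤ d
    correct : ∀ (h : Fin M → Fin N) (s : RSol k) →
      RValid k (λ u v → eval (inst u v) h) s →
      IsCollision t M N h (eval (back s) h)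
    cost : d * ⌈log₂ N ⌉ + 2 * k ≤ polylogBound c M N

record BiRamseyRed (c t M N : ℕ) : Set where
  field
    k     : ℕ
    d     : ℕ
    inst  : Vtx k → Vtx k → DT M N Bool
    back  : BSol k → DT M N (Fin t → Fin M)
    inst-depth : ∀ u v → depth (inst u v) ≤ d
    back-depth : ∀ s → depth (back s) ≤ d
    correct : ∀ (h : Fin M → Fin N) (s : BSol k) →
      BValid k (λ u v → eval (inst u v) h) s →
      IsCollision t M N h (eval (back s) h)
    cost : d * ⌈log₂ N ⌉ + 2 * k ≤ polylogBound c M N

-- Parameter hypotheses:  M ≥ N^(4t) / 4^t  and  M > (t-1) N.
PigeonParams : ℕ → ℕ → ℕ → Set
PigeonParams t M N = (N ^ (4 * t) ≤ 4 ^ t * M) × (t * N < M + N)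

-- Erdős's first-moment argument gives, for m = ⌊log₂ N²⌋ ≥ 5, a graph on the N holes with no
-- homogeneous m-set and a bipartite graph on N + N holes with no homogeneous m × m rectangle:
-- summed over all (bipartite) graphs, the number of homogeneous configurations is smaller than
-- the number of graphs. The target instance colours the pair of pigeons u, v by the edge between
-- their holes h u, h v. It has no loops and no asymmetric pairs, so a solution is a homogeneous
-- set of s = (t − 1)(m − 1) + 1 pigeons (on each side). Querying their holes exhibits t pigeons
-- in one hole, or else at least m occupied holes, which would be homogeneous in the Ramsey graph.
-- The hypothesis M ≥ N^(4t)/4^t provides the 2^(2s) pigeons used as vertices. When t ≤ 1 or
-- N ≤ 5 the back map finds a collision by itself: some t of any (t − 1)N + 1 pigeons share a hole.

module Submission where

open import Defs
open import Data.Nat using (ℕ)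
open import Data.Product using (Σ; _×_)

open import Data.Bool.Base using (Bool; true; false; not; _∧_)
open import Data.Bool.Properties using (∧-zeroʳ; ∧-identityʳ)
open import Data.Empty using (⊥; ⊥-elim)
open import Data.Fin.Base using (Fin; zero; suc; inject≤; fromℕ<)
open import Data.Fin.Properties using (_≟_; any?)
import Data.Fin.Properties as Finₚ
open import Data.List.Base as List using (List; []; downFrom)
open import Data.Nat.Base
open import Data.Nat.Combinatorics using (_C_; nCk+nC[k+1]≡[n+1]C[k+1]; nC1≡n)
open import Data.Nat.DivMod using (_/_; m/n≤m; m/n*n≤m; m*n/n≡m)
open import Data.Nat.ListAction using (sum)
open import Data.Nat.Logarithm using (⌈log₂_⌉; ⌈log₂⌉-mono-≤; ⌈log₂2^n⌉≡n)
open import Data.Nat.Properties hiding (_≟_)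
open import Data.Nat.Tactic.RingSolver using (solve-∀)
open import Algebra.Properties.CommutativeSemigroup +-commutativeSemigroup
  using () renaming (interchange to +-interchange)
open import Algebra.Properties.CommutativeSemigroup *-commutativeSemigroup
  using () renaming (interchange to *-interchange)
open import Algebra.Properties.Semiring.Sum +-*-semiring
  using (sum-syntax; ∑-comm; sum-cong-≗; sum-replicate-zero; *-distribˡ-sum)
open import Data.Product.Base using (_,_; ∃; proj₂)
open import Data.Sum.Base using (_⊎_; inj₁; inj₂; [_,_]′)
open import Data.Unit.Base using (⊤; tt)
open import Data.Vec.Functional as Vector using (Vector; _∷_; head; tail; replicate)
open import Function.Base using (_∘_; _∘′_; const)
open import Function.Definitions using (Injective)
open import Relation.Binary.PropositionalEquality
open import Relation.Nullary using (¬_; yes; no; does; contradiction)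
open import Relation.Nullary.Decidable using (toWitness)

Bits : ℕ → Set
Bits = Vector Bool

sumBits : ∀ n → (Bits n → ℕ) → ℕ
sumBits zero    f = f Vector.[]
sumBits (suc n) f = sumBits n (f ∘ (true ∷_)) + sumBits n (f ∘ (false ∷_))

sumBits-cong : ∀ n {f g : Bits n → ℕ} → (∀ v → f v ≡ g v) → sumBits n f ≡ sumBits n g
sumBits-cong zero    f≗g = f≗g _
sumBits-cong (suc n) f≗g = cong₂ _+_ (sumBits-cong n (f≗g ∘ _)) (sumBits-cong n (f≗g ∘ _))

sumBits-distrib-+ : ∀ n (f g : Bits n → ℕ) →
                    sumBits n (λ v → f v + g v) ≡ sumBits n f + sumBits n g
sumBits-distrib-+ zero    f g = refl
sumBits-distrib-+ (suc n) f g =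
  trans (cong₂ _+_ (sumBits-distrib-+ n _ _) (sumBits-distrib-+ n _ _))
        (+-interchange (sumBits n (f ∘ (true ∷_))) (sumBits n (g ∘ (true ∷_)))
                       (sumBits n (f ∘ (false ∷_))) (sumBits n (g ∘ (false ∷_))))

sumBits-distribˡ-* : ∀ n k (f : Bits n → ℕ) → sumBits n (λ v → k * f v) ≡ k * sumBits n f
sumBits-distribˡ-* zero    k f = refl
sumBits-distribˡ-* (suc n) k f =
  trans (cong₂ _+_ (sumBits-distribˡ-* n k _) (sumBits-distribˡ-* n k _)) (sym (*-distribˡ-+ k _ _))

sumBits-const : ∀ n k → sumBits n (const k) ≡ 2 ^ n * k
sumBits-const zero    k = sym (+-identityʳ k)
sumBits-const (suc n) k = begin
  sumBits n (const k) + sumBits n (const k) ≡⟨ cong (λ x → x + x) (sumBits-const n k) ⟩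
  2 ^ n * k + 2 ^ n * k                     ≡⟨ *-distribʳ-+ k (2 ^ n) _ ⟨
  (2 ^ n + 2 ^ n) * k                       ≡⟨ cong (λ x → (2 ^ n + x) * k) (+-identityʳ (2 ^ n)) ⟨
  2 ^ suc n * k                             ∎
  where open ≡-Reasoning

sumBits-<⇒∃< : ∀ n (f g : Bits n → ℕ) → sumBits n f < sumBits n g → ∃ λ v → f v < g v
sumBits-<⇒∃< zero    f g f<g = _ , f<g
sumBits-<⇒∃< (suc n) f g f<g
  with sumBits n (f ∘ (true ∷_)) <? sumBits n (g ∘ (true ∷_))
     | sumBits n (f ∘ (false ∷_)) <? sumBits n (g ∘ (false ∷_))
... | yes f<g₁ | _        = _ , proj₂ (sumBits-<⇒∃< n _ _ f<g₁)
... | no  _    | yes f<g₂ = _ , proj₂ (sumBits-<⇒∃< n _ _ f<g₂)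
... | no  f≮g₁ | no  f≮g₂ = contradiction f<g (≤⇒≯ (+-mono-≤ (≮⇒≥ f≮g₁) (≮⇒≥ f≮g₂)))

Bits⋆ : List ℕ → Set
Bits⋆ []            = ⊤
Bits⋆ (d List.∷ ds) = Bits d × Bits⋆ ds

sumBits⋆ : ∀ ds → (Bits⋆ ds → ℕ) → ℕ
sumBits⋆ []            f = f tt
sumBits⋆ (d List.∷ ds) f = sumBits d (λ v → sumBits⋆ ds (λ x → f (v , x)))

sumBits⋆-distrib-+ : ∀ ds (f g : Bits⋆ ds → ℕ) →
                     sumBits⋆ ds (λ x → f x + g x) ≡ sumBits⋆ ds f + sumBits⋆ ds g
sumBits⋆-distrib-+ []            f g = refl
sumBits⋆-distrib-+ (d List.∷ ds) f g =
  trans (sumBits-cong d (λ v → sumBits⋆-distrib-+ ds _ _)) (sumBits-distrib-+ d _ _)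

sumBits⋆-distribˡ-* : ∀ ds k (f : Bits⋆ ds → ℕ) → sumBits⋆ ds (λ x → k * f x) ≡ k * sumBits⋆ ds f
sumBits⋆-distribˡ-* []            k f = refl
sumBits⋆-distribˡ-* (d List.∷ ds) k f =
  trans (sumBits-cong d (λ v → sumBits⋆-distribˡ-* ds k _)) (sumBits-distribˡ-* d k _)

sumBits⋆-const : ∀ ds k → sumBits⋆ ds (const k) ≡ 2 ^ sum ds * k
sumBits⋆-const []            k = sym (+-identityʳ k)
sumBits⋆-const (d List.∷ ds) k = begin
  sumBits d (λ _ → sumBits⋆ ds (const k)) ≡⟨ sumBits-cong d (λ _ → sumBits⋆-const ds k) ⟩
  sumBits d (const (2 ^ sum ds * k))      ≡⟨ sumBits-const d _ ⟩
  2 ^ d * (2 ^ sum ds * k)                ≡⟨ *-assoc (2 ^ d) _ k ⟨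
  2 ^ d * 2 ^ sum ds * k                  ≡⟨ cong (_* k) (^-distribˡ-+-* 2 d (sum ds)) ⟨
  2 ^ (d + sum ds) * k                    ∎
  where open ≡-Reasoning

sumBits⋆-<⇒∃< : ∀ ds (f g : Bits⋆ ds → ℕ) → sumBits⋆ ds f < sumBits⋆ ds g → ∃ λ x → f x < g x
sumBits⋆-<⇒∃< []            f g f<g = tt , f<g
sumBits⋆-<⇒∃< (d List.∷ ds) f g f<g =
  let v , f<gᵥ = sumBits-<⇒∃< d _ _ f<g
      x , f<gₓ = sumBits⋆-<⇒∃< ds _ _ f<gᵥ
  in (v , x) , f<gₓ

firstMoment : ∀ ds (f : Bits⋆ ds → ℕ) {K P} →
              sumBits⋆ ds f * P ≡ K * 2 ^ sum ds → K < P → ∃ λ x → f x ≡ 0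
firstMoment ds f {K} {P} total K<P =
  let x , fx<1 = sumBits⋆-<⇒∃< ds f (const 1) sum<size in x , n<1⇒n≡0 fx<1
  where
  open ≤-Reasoning
  sum<size : sumBits⋆ ds f < sumBits⋆ ds (const 1)
  sum<size = *-cancelʳ-< P _ _ (begin-strict
    sumBits⋆ ds f * P          ≡⟨ total ⟩
    K * 2 ^ sum ds             <⟨ *-monoˡ-< (2 ^ sum ds) {{m^n≢0 2 (sum ds)}} K<P ⟩
    P * 2 ^ sum ds             ≡⟨ *-comm P _ ⟩
    2 ^ sum ds * P             ≡⟨ cong (_* P) (*-identityʳ (2 ^ sum ds)) ⟨
    2 ^ sum ds * 1 * P         ≡⟨ cong (_* P) (sumBits⋆-const ds 1) ⟨
    sumBits⋆ ds (const 1) * P  ∎)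

firstMoment-pair : ∀ ds (f : Bool → Bits⋆ ds → ℕ) {K P} →
                   (∀ c → sumBits⋆ ds (f c) * P ≡ K * 2 ^ sum ds) → 2 * K < P →
                   ∃ λ x → ∀ c → f c x ≡ 0
firstMoment-pair ds f {K} {P} total 2K<P =
  let x , none = firstMoment ds both both-total 2K<P in x , λ c → zero-of c none
  where
  open ≡-Reasoning
  both : Bits⋆ ds → ℕ
  both x = f true x + f false x
  both-total : sumBits⋆ ds both * P ≡ 2 * K * 2 ^ sum ds
  both-total = begin
    sumBits⋆ ds both * P
      ≡⟨ cong (_* P) (sumBits⋆-distrib-+ ds (f true) (f false)) ⟩
    (sumBits⋆ ds (f true) + sumBits⋆ ds (f false)) * P
      ≡⟨ *-distribʳ-+ P (sumBits⋆ ds (f true)) _ ⟩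
    sumBits⋆ ds (f true) * P + sumBits⋆ ds (f false) * P
      ≡⟨ cong₂ _+_ (total true) (total false) ⟩
    K * 2 ^ sum ds + K * 2 ^ sum ds
      ≡⟨ *-distribʳ-+ (2 ^ sum ds) K _ ⟨
    (K + K) * 2 ^ sum ds
      ≡⟨ cong (λ k → (K + k) * 2 ^ sum ds) (+-identityʳ K) ⟨
    2 * K * 2 ^ sum ds ∎
  zero-of : ∀ {x} c → both x ≡ 0 → f c x ≡ 0
  zero-of {x} true  none = m+n≡0⇒m≡0 (f true x) none
  zero-of {x} false none = m+n≡0⇒n≡0 (f true x) none

bit : Bool → ℕ
bit false = 0
bit true  = 1

∣_∣ : ∀ {n} → Bits n → ℕ
∣_∣ {n} W = ∑[ i < n ] bit (W i)

_⊆_ : ∀ {n} → Bits n → Bits n → Set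
A ⊆ B = ∀ i → A i ≡ true → B i ≡ true

bit-mono : ∀ {a b} → (a ≡ true → b ≡ true) → bit a ≤ bit b
bit-mono {false}         _   = z≤n
bit-mono {true}  {true}  _   = ≤-refl
bit-mono {true}  {false} a⇒b with () ← a⇒b refl

∣∣-mono : ∀ {n} {A B : Bits n} → A ⊆ B → ∣ A ∣ ≤ ∣ B ∣
∣∣-mono {zero}  A⊆B = z≤n
∣∣-mono {suc n} A⊆B = +-mono-≤ (bit-mono (A⊆B zero)) (∣∣-mono (A⊆B ∘ suc))

∣replicate-true∣ : ∀ n → ∣ replicate n true ∣ ≡ n
∣replicate-true∣ zero    = refl
∣replicate-true∣ (suc n) = cong suc (∣replicate-true∣ n)

∣∣≤n : ∀ {n} (W : Bits n) → ∣ W ∣ ≤ n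
∣∣≤n {n} W = subst (∣ W ∣ ≤_) (∣replicate-true∣ n) (∣∣-mono {B = replicate n true} (λ _ _ → refl))

C-positive : ∀ {n k} → k ≤ n → 0 < n C k
C-positive {n}     {zero}  _         = s≤s z≤n
C-positive {suc n} {suc k} (s≤s k≤n) =
  subst (0 <_) (nCk+nC[k+1]≡[n+1]C[k+1] n k) (≤-trans (C-positive k≤n) (m≤m+n _ _))

_==_ : Bool → Bool → Bool
true  == c = c
false == c = not c

==-refl : ∀ c → (c == c) ≡ true
==-refl true  = refl
==-refl false = refl

not-== : ∀ c → (not c == c) ≡ false
not-== true  = refl
not-== false = refl

_∩[_==_] : ∀ {n} → Bits n → Bits n → Bool → Bits n
(W ∩[ v == c ]) i = W i ∧ (v i == c)

sumBits-split : ∀ n c (f : Bits (suc n) → ℕ) →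
                sumBits (suc n) f ≡ sumBits n (f ∘ (c ∷_)) + sumBits n (f ∘ (not c ∷_))
sumBits-split n true  f = refl
sumBits-split n false f = +-comm (sumBits n (f ∘ (true ∷_))) _

sumBits-∣∩∣C-step : ∀ n (Y : Bits n → ℕ) y →
                     (∀ j → sumBits n (λ v → Y v C j) * 2 ^ j ≡ (y C j) * 2 ^ n) →
                     ∀ b m → (sumBits n (λ v → (bit b + Y v) C m) + sumBits n (λ v → Y v C m)) * 2 ^ m
                             ≡ ((bit b + y) C m) * 2 ^ suc n
sumBits-∣∩∣C-step n Y y ih false m = begin
  (S m + S m) * 2 ^ m      ≡⟨ double (S m) (2 ^ m) ⟩
  2 * (S m * 2 ^ m)        ≡⟨ cong (2 *_) (ih m) ⟩
  2 * ((y C m) * 2 ^ n)    ≡⟨ swap (y C m) (2 ^ n) ⟩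
  (y C m) * 2 ^ suc n      ∎
  where
  open ≡-Reasoning
  S : ℕ → ℕ
  S j = sumBits n (λ v → Y v C j)
  double : ∀ a b → (a + a) * b ≡ 2 * (a * b)
  double = solve-∀
  swap : ∀ a b → 2 * (a * b) ≡ a * (2 * b)
  swap = solve-∀
sumBits-∣∩∣C-step n Y y ih true zero = begin
  (sumBits n (const 1) + sumBits n (const 1)) * 1 ≡⟨ cong (λ x → (x + x) * 1) (sumBits-const n 1) ⟩
  (2 ^ n * 1 + 2 ^ n * 1) * 1                     ≡⟨ arith (2 ^ n) ⟩
  1 * 2 ^ suc n                                   ∎
  where
  open ≡-Reasoning
  arith : ∀ a → (a * 1 + a * 1) * 1 ≡ 1 * (2 * a)
  arith = solve-∀
sumBits-∣∩∣C-step n Y y ih true (suc j) = begin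
  (sumBits n (λ v → suc (Y v) C suc j) + S (suc j)) * 2 ^ suc j
    ≡⟨ cong (λ x → (x + S (suc j)) * 2 ^ suc j)
            (sumBits-cong n (λ v → nCk+nC[k+1]≡[n+1]C[k+1] (Y v) j)) ⟨
  (sumBits n (λ v → Y v C j + Y v C suc j) + S (suc j)) * 2 ^ suc j
    ≡⟨ cong (λ x → (x + S (suc j)) * 2 ^ suc j) (sumBits-distrib-+ n _ _) ⟩
  (S j + S (suc j) + S (suc j)) * 2 ^ suc j         ≡⟨ regroup (S j) (S (suc j)) (2 ^ j) ⟩
  2 * (S j * 2 ^ j) + 2 * (S (suc j) * 2 ^ suc j)   ≡⟨ cong₂ (λ a b → 2 * a + 2 * b) (ih j) (ih (suc j)) ⟩
  2 * ((y C j) * 2 ^ n) + 2 * ((y C suc j) * 2 ^ n) ≡⟨ collect (y C j) (y C suc j) (2 ^ n) ⟩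
  (y C j + y C suc j) * 2 ^ suc n                   ≡⟨ cong (_* 2 ^ suc n) (nCk+nC[k+1]≡[n+1]C[k+1] y j) ⟩
  (suc y C suc j) * 2 ^ suc n                       ∎
  where
  open ≡-Reasoning
  S : ℕ → ℕ
  S j = sumBits n (λ v → Y v C j)
  regroup : ∀ a b p → (a + b + b) * (2 * p) ≡ 2 * (a * p) + 2 * (b * (2 * p))
  regroup = solve-∀
  collect : ∀ a b p → 2 * (a * p) + 2 * (b * p) ≡ (a + b) * (2 * p)
  collect = solve-∀

-- An m-subset of W lies in {i | v i ≡ c} for exactly 2 ^ (n ∸ m) of the vectors v.
sumBits-∣∩∣C : ∀ n m c (W : Bits n) →
               sumBits n (λ v → ∣ W ∩[ v == c ] ∣ C m) * 2 ^ m ≡ (∣ W ∣ C m) * 2 ^ n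
sumBits-∣∩∣C zero    zero    c W = refl
sumBits-∣∩∣C zero    (suc m) c W = refl
sumBits-∣∩∣C (suc n) m c W = begin
  sumBits (suc n) (λ v → ∣ W ∩[ v == c ] ∣ C m) * 2 ^ m
    ≡⟨ cong (_* 2 ^ m) (sumBits-split n c (λ v → ∣ W ∩[ v == c ] ∣ C m)) ⟩
  (sumBits n (λ v → (bit (head W ∧ (c == c)) + Y v) C m)
    + sumBits n (λ v → (bit (head W ∧ (not c == c)) + Y v) C m)) * 2 ^ m
    ≡⟨ cong₂ (λ a b → (sumBits n (λ v → (bit a + Y v) C m) + sumBits n (λ v → (bit b + Y v) C m)) * 2 ^ m)
             (trans (cong (head W ∧_) (==-refl c)) (∧-identityʳ (head W)))
             (trans (cong (head W ∧_) (not-== c)) (∧-zeroʳ (head W))) ⟩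
  (sumBits n (λ v → (bit (head W) + Y v) C m) + sumBits n (λ v → Y v C m)) * 2 ^ m
    ≡⟨ sumBits-∣∩∣C-step n Y ∣ tail W ∣ (λ j → sumBits-∣∩∣C n j c (tail W)) (head W) m ⟩
  (∣ W ∣ C m) * 2 ^ suc n ∎
  where
  open ≡-Reasoning
  Y : Bits n → ℕ
  Y v = ∣ tail W ∩[ v == c ] ∣

-- Ramsey graphs

-- A graph on suc n vertices is the neighbourhood of vertex zero among the others, together
-- with the graph they span.
Graph : ℕ → Set
Graph n = Bits⋆ (downFrom n)

pairs : ℕ → ℕ
pairs n = sum (downFrom n)

adj : ∀ {n} → Graph n → Fin n → Fin n → Bool
adj {suc n} (v , G) zero    zero    = false
adj {suc n} (v , G) zero    (suc j) = v j
adj {suc n} (v , G) (suc i) zero    = v i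
adj {suc n} (v , G) (suc i) (suc j) = adj G i j

adj-sym : ∀ {n} (G : Graph n) i j → adj G i j ≡ adj G j i
adj-sym {suc n} (v , G) zero    zero    = refl
adj-sym {suc n} (v , G) zero    (suc j) = refl
adj-sym {suc n} (v , G) (suc i) zero    = refl
adj-sym {suc n} (v , G) (suc i) (suc j) = adj-sym G i j

adj-irrefl : ∀ {n} (G : Graph n) i → adj G i i ≡ false
adj-irrefl {suc n} (v , G) zero    = refl
adj-irrefl {suc n} (v , G) (suc i) = adj-irrefl G i

-- The number of m-subsets of W on which every edge has colour c.
homCount : Bool → ℕ → ∀ {n} → Graph n → Bits n → ℕ
homCount c zero    {n}     G       W = 1
homCount c (suc m) {zero}  G       W = 0
homCount c (suc m) {suc n} (v , G) W =
  homCount c (suc m) G (tail W) + bit (head W) * homCount c m G (tail W ∩[ v == c ])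

bit-pascal : ∀ b y m → ((bit b + y) C suc m) ≡ y C suc m + bit b * (y C m)
bit-pascal false y m = sym (+-identityʳ _)
bit-pascal true  y m = trans (sym (nCk+nC[k+1]≡[n+1]C[k+1] y m))
                             (trans (+-comm (y C m) _) (cong (y C suc m +_) (sym (+-identityʳ _))))

-- Each m-subset of W is c-homogeneous in exactly 2 ^ (pairs n ∸ pairs m) of the graphs.
sumBits⋆-homCount : ∀ n m c (W : Bits n) →
  sumBits⋆ (downFrom n) (λ G → homCount c m G W) * 2 ^ pairs m ≡ (∣ W ∣ C m) * 2 ^ pairs n
sumBits⋆-homCount n zero c W = begin
  sumBits⋆ (downFrom n) (const 1) * 1 ≡⟨ cong (_* 1) (sumBits⋆-const (downFrom n) 1) ⟩
  2 ^ pairs n * 1 * 1                  ≡⟨ arith (2 ^ pairs n) ⟩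
  1 * 2 ^ pairs n                      ∎
  where
  open ≡-Reasoning
  arith : ∀ a → a * 1 * 1 ≡ 1 * a
  arith = solve-∀
sumBits⋆-homCount zero    (suc m) c W = refl
sumBits⋆-homCount (suc n) (suc m) c W = begin
  sumBits n (λ v → sumBits⋆ (downFrom n) (λ G → homCount c (suc m) G W' + w * homCount c m G (W' ∩[ v == c ])))
    * 2 ^ (m + pairs m)
    ≡⟨ cong₂ _*_ (sumBits-cong n (λ v → trans (sumBits⋆-distrib-+ (downFrom n) _ _)
                                              (cong (A +_) (sumBits⋆-distribˡ-* (downFrom n) w _))))
                 (^-distribˡ-+-* 2 m (pairs m)) ⟩
  sumBits n (λ v → A + w * B v) * (2 ^ m * 2 ^ pairs m)
    ≡⟨ cong (_* (2 ^ m * 2 ^ pairs m)) (trans (sumBits-distrib-+ n _ _)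
                                        (cong₂ _+_ (sumBits-const n A) (sumBits-distribˡ-* n w B))) ⟩
  (2 ^ n * A + w * sumBits n B) * (2 ^ m * 2 ^ pairs m)
    ≡⟨ regroup (2 ^ n) A w (sumBits n B) (2 ^ m) (2 ^ pairs m) ⟩
  2 ^ n * (A * (2 ^ m * 2 ^ pairs m)) + w * (sumBits n B * 2 ^ pairs m * 2 ^ m)
    ≡⟨ cong₂ (λ a b → 2 ^ n * a + w * b) sumA sumB ⟩
  2 ^ n * ((y C suc m) * 2 ^ pairs n) + w * ((y C m) * 2 ^ n * 2 ^ pairs n)
    ≡⟨ collect (2 ^ n) (y C suc m) (2 ^ pairs n) w (y C m) ⟩
  (y C suc m + w * (y C m)) * (2 ^ n * 2 ^ pairs n)
    ≡⟨ cong₂ _*_ (bit-pascal (head W) y m) (^-distribˡ-+-* 2 n (pairs n)) ⟨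
  ((bit (head W) + y) C suc m) * 2 ^ (n + pairs n) ∎
  where
  open ≡-Reasoning
  W' : Bits n
  W' = tail W
  w y A : ℕ
  w = bit (head W)
  y = ∣ W' ∣
  A = sumBits⋆ (downFrom n) (λ G → homCount c (suc m) G W')
  B : Bits n → ℕ
  B v = sumBits⋆ (downFrom n) (λ G → homCount c m G (W' ∩[ v == c ]))
  regroup : ∀ q a w b r p → (q * a + w * b) * (r * p) ≡ q * (a * (r * p)) + w * (b * p * r)
  regroup = solve-∀
  collect : ∀ q a p w b → q * (a * p) + w * (b * q * p) ≡ (a + w * b) * (q * p)
  collect = solve-∀
  sumA : A * (2 ^ m * 2 ^ pairs m) ≡ (y C suc m) * 2 ^ pairs n
  sumA = trans (cong (A *_) (sym (^-distribˡ-+-* 2 m (pairs m)))) (sumBits⋆-homCount n (suc m) c W')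
  sumB : sumBits n B * 2 ^ pairs m * 2 ^ m ≡ (y C m) * 2 ^ n * 2 ^ pairs n
  sumB = begin
    sumBits n B * 2 ^ pairs m * 2 ^ m
      ≡⟨ cong (_* 2 ^ m) (trans (*-comm (sumBits n B) _) (sym (sumBits-distribˡ-* n (2 ^ pairs m) B))) ⟩
    sumBits n (λ v → 2 ^ pairs m * B v) * 2 ^ m
      ≡⟨ cong (_* 2 ^ m) (sumBits-cong n (λ v → trans (*-comm _ (B v)) (sumBits⋆-homCount n m c (W' ∩[ v == c ])))) ⟩
    sumBits n (λ v → (∣ W' ∩[ v == c ] ∣ C m) * 2 ^ pairs n) * 2 ^ m
      ≡⟨ cong (_* 2 ^ m) (trans (sumBits-cong n (λ v → *-comm _ (2 ^ pairs n))) (sumBits-distribˡ-* n (2 ^ pairs n) _)) ⟩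
    2 ^ pairs n * sumBits n (λ v → ∣ W' ∩[ v == c ] ∣ C m) * 2 ^ m
      ≡⟨ trans (*-assoc (2 ^ pairs n) _ _) (cong (2 ^ pairs n *_) (sumBits-∣∩∣C n m c W')) ⟩
    2 ^ pairs n * ((y C m) * 2 ^ n)
      ≡⟨ *-comm (2 ^ pairs n) _ ⟩
    (y C m) * 2 ^ n * 2 ^ pairs n ∎

IsHomogeneous : Bool → ∀ {n} → Graph n → Bits n → Set
IsHomogeneous c G A = ∀ i j → i ≢ j → A i ≡ true → A j ≡ true → adj G i j ≡ c

homogeneous-tail : ∀ c {n} {v : Bits n} {G : Graph n} {A : Bits (suc n)} →
                   IsHomogeneous c (v , G) A → IsHomogeneous c G (tail A)
homogeneous-tail c hom i j i≢j = hom (suc i) (suc j) (i≢j ∘ Finₚ.suc-injective)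

homCount-positive : ∀ c m {n} (G : Graph n) {A W : Bits n} →
                    A ⊆ W → m ≤ ∣ A ∣ → IsHomogeneous c G A → 1 ≤ homCount c m G W
homCount-positive c zero    G A⊆W m≤∣A∣ hom = ≤-refl
homCount-positive c (suc m) {suc n} (v , G) {A} {W} A⊆W m≤∣A∣ hom with head A in A₀
... | false = ≤-trans (homCount-positive c (suc m) G (A⊆W ∘ suc) m≤∣A∣ (homogeneous-tail c hom))
                      (m≤m+n _ _)
... | true rewrite A⊆W zero A₀ =
  ≤-trans (homCount-positive c m G A'⊆ (≤-pred m≤∣A∣) (homogeneous-tail c hom))
          (≤-trans (≤-reflexive (sym (+-identityʳ _))) (m≤n+m _ (homCount c (suc m) G (tail W))))
  where
  A'⊆ : tail A ⊆ (tail W ∩[ v == c ])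
  A'⊆ i Aᵢ rewrite A⊆W (suc i) Aᵢ | hom zero (suc i) (λ ()) A₀ Aᵢ = ==-refl c

IsRamseyGraph : ℕ → ∀ {n} → Graph n → Set
IsRamseyGraph m G = ∀ c A → m ≤ ∣ A ∣ → ¬ IsHomogeneous c G A

ramseyGraph-exists : ∀ N m → 2 * (N C m) < 2 ^ pairs m → Σ (Graph N) (IsRamseyGraph m)
ramseyGraph-exists N m 2C<2^pairs =
  let G , none = firstMoment-pair (downFrom N) count {K = N C m} total 2C<2^pairs
  in G , λ c A m≤∣A∣ hom →
       n≮0 (subst (1 ≤_) (none c) (homCount-positive c m G (λ _ _ → refl) m≤∣A∣ hom))
  where
  count : Bool → Graph N → ℕ
  count c G = homCount c m G (replicate N true)
  total : ∀ c → sumBits⋆ (downFrom N) (count c) * 2 ^ pairs m ≡ (N C m) * 2 ^ pairs N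
  total c = trans (sumBits⋆-homCount N m c _) (cong (λ x → (x C m) * 2 ^ pairs N) (∣replicate-true∣ N))

-- Bipartite Ramsey graphs

BiGraph : ℕ → ℕ → Set
BiGraph n N = Bits⋆ (List.replicate n N)

sum-replicate : ∀ n N → sum (List.replicate n N) ≡ n * N
sum-replicate zero    N = refl
sum-replicate (suc n) N = cong (N +_) (sum-replicate n N)

row : ∀ {n N} → BiGraph n N → Fin n → Bits N
row (r , R) zero    = r
row (r , R) (suc i) = row R i

-- The number of pairs of an a-set of rows and an m-subset of V spanning a rectangle of colour c.
rectCount : Bool → (a m : ℕ) → ∀ {n N} → BiGraph n N → Bits N → ℕ
rectCount c zero    m         R       V = ∣ V ∣ C m
rectCount c (suc a) m {zero}  R       V = 0
rectCount c (suc a) m {suc n} (r , R) V = rectCount c (suc a) m R V + rectCount c a m R (V ∩[ r == c ])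

sumBits⋆-rectCount : ∀ n N a m c (V : Bits N) →
  sumBits⋆ (List.replicate n N) (λ R → rectCount c a m R V) * 2 ^ (a * m)
    ≡ (n C a) * (∣ V ∣ C m) * 2 ^ (n * N)
sumBits⋆-rectCount n N zero m c V = begin
  sumBits⋆ (List.replicate n N) (const (∣ V ∣ C m)) * 1 ≡⟨ cong (_* 1) (sumBits⋆-const (List.replicate n N) _) ⟩
  2 ^ sum (List.replicate n N) * (∣ V ∣ C m) * 1         ≡⟨ cong (λ e → 2 ^ e * (∣ V ∣ C m) * 1) (sum-replicate n N) ⟩
  2 ^ (n * N) * (∣ V ∣ C m) * 1                          ≡⟨ arith (2 ^ (n * N)) (∣ V ∣ C m) ⟩
  1 * (∣ V ∣ C m) * 2 ^ (n * N)                          ∎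
  where
  open ≡-Reasoning
  arith : ∀ p b → p * b * 1 ≡ 1 * b * p
  arith = solve-∀
sumBits⋆-rectCount zero    N (suc a) m c V = refl
sumBits⋆-rectCount (suc n) N (suc a) m c V = begin
  sumBits N (λ r → sumBits⋆ (List.replicate n N) (λ R → rectCount c (suc a) m R V + rectCount c a m R (V ∩[ r == c ])))
    * 2 ^ (m + a * m)
    ≡⟨ cong₂ _*_ (trans (sumBits-cong N (λ r → sumBits⋆-distrib-+ (List.replicate n N) _ _))
                        (trans (sumBits-distrib-+ N _ _) (cong (_+ sumBits N B) (sumBits-const N A))))
                 (^-distribˡ-+-* 2 m (a * m)) ⟩
  (2 ^ N * A + sumBits N B) * (2 ^ m * 2 ^ (a * m))
    ≡⟨ regroup (2 ^ N) A (sumBits N B) (2 ^ m) (2 ^ (a * m)) ⟩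
  2 ^ N * (A * (2 ^ m * 2 ^ (a * m))) + sumBits N B * 2 ^ (a * m) * 2 ^ m
    ≡⟨ cong₂ (λ x y → 2 ^ N * x + y) sumA sumB ⟩
  2 ^ N * ((n C suc a) * v * 2 ^ (n * N)) + (n C a) * 2 ^ (n * N) * (v * 2 ^ N)
    ≡⟨ collect (2 ^ N) (n C suc a) v (2 ^ (n * N)) (n C a) ⟩
  ((n C a) + (n C suc a)) * v * (2 ^ N * 2 ^ (n * N))
    ≡⟨ cong₂ (λ x y → x * v * y) (nCk+nC[k+1]≡[n+1]C[k+1] n a) (sym (^-distribˡ-+-* 2 N (n * N))) ⟩
  (suc n C suc a) * v * 2 ^ (N + n * N) ∎
  where
  open ≡-Reasoning
  v A : ℕ
  v = ∣ V ∣ C m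
  A = sumBits⋆ (List.replicate n N) (λ R → rectCount c (suc a) m R V)
  B : Bits N → ℕ
  B r = sumBits⋆ (List.replicate n N) (λ R → rectCount c a m R (V ∩[ r == c ]))
  regroup : ∀ q a b r p → (q * a + b) * (r * p) ≡ q * (a * (r * p)) + b * p * r
  regroup = solve-∀
  collect : ∀ q a v p b → q * (a * v * p) + b * p * (v * q) ≡ (b + a) * v * (q * p)
  collect = solve-∀
  sumA : A * (2 ^ m * 2 ^ (a * m)) ≡ (n C suc a) * v * 2 ^ (n * N)
  sumA = trans (cong (A *_) (sym (^-distribˡ-+-* 2 m (a * m)))) (sumBits⋆-rectCount n N (suc a) m c V)
  sumB : sumBits N B * 2 ^ (a * m) * 2 ^ m ≡ (n C a) * 2 ^ (n * N) * (v * 2 ^ N)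
  sumB = begin
    sumBits N B * 2 ^ (a * m) * 2 ^ m
      ≡⟨ cong (_* 2 ^ m) (trans (*-comm (sumBits N B) _) (sym (sumBits-distribˡ-* N (2 ^ (a * m)) B))) ⟩
    sumBits N (λ r → 2 ^ (a * m) * B r) * 2 ^ m
      ≡⟨ cong (_* 2 ^ m) (sumBits-cong N (λ r → trans (*-comm _ (B r)) (sumBits⋆-rectCount n N a m c _))) ⟩
    sumBits N (λ r → (n C a) * (∣ V ∩[ r == c ] ∣ C m) * 2 ^ (n * N)) * 2 ^ m
      ≡⟨ cong (_* 2 ^ m) (trans (sumBits-cong N (λ r → swap (n C a) _ (2 ^ (n * N))))
                                (sumBits-distribˡ-* N ((n C a) * 2 ^ (n * N)) _)) ⟩
    (n C a) * 2 ^ (n * N) * sumBits N (λ r → ∣ V ∩[ r == c ] ∣ C m) * 2 ^ m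
      ≡⟨ trans (*-assoc ((n C a) * 2 ^ (n * N)) _ _) (cong ((n C a) * 2 ^ (n * N) *_) (sumBits-∣∩∣C N m c V)) ⟩
    (n C a) * 2 ^ (n * N) * (v * 2 ^ N) ∎
    where
    swap : ∀ x y z → x * y * z ≡ x * z * y
    swap = solve-∀

IsHomogeneousRect : Bool → ∀ {n N} → BiGraph n N → Bits n → Bits N → Set
IsHomogeneousRect c R U V = ∀ i j → U i ≡ true → V j ≡ true → row R i j ≡ c

rectCount-positive : ∀ c a m {n N} (R : BiGraph n N) {U : Bits n} {V₀ V : Bits N} →
                     V₀ ⊆ V → a ≤ ∣ U ∣ → m ≤ ∣ V₀ ∣ → IsHomogeneousRect c R U V₀ →
                     1 ≤ rectCount c a m R V
rectCount-positive c zero m R V₀⊆V a≤∣U∣ m≤∣V₀∣ hom = C-positive (≤-trans m≤∣V₀∣ (∣∣-mono V₀⊆V))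
rectCount-positive c (suc a) m {suc n} (r , R) {U} {V₀} {V} V₀⊆V a≤∣U∣ m≤∣V₀∣ hom with head U in U₀
... | false = ≤-trans (rectCount-positive c (suc a) m R V₀⊆V a≤∣U∣ m≤∣V₀∣ (hom ∘ suc)) (m≤m+n _ _)
... | true  = ≤-trans (rectCount-positive c a m R V₀⊆V∩r (≤-pred a≤∣U∣) m≤∣V₀∣ (hom ∘ suc)) (m≤n+m _ _)
  where
  V₀⊆V∩r : V₀ ⊆ (V ∩[ r == c ])
  V₀⊆V∩r j V₀ⱼ rewrite V₀⊆V j V₀ⱼ | hom zero j U₀ V₀ⱼ = ==-refl c

IsBiRamseyGraph : ℕ → ∀ {N} → BiGraph N N → Set
IsBiRamseyGraph m R = ∀ c U V → m ≤ ∣ U ∣ → m ≤ ∣ V ∣ → ¬ IsHomogeneousRect c R U V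

biRamseyGraph-exists : ∀ N m → 2 * ((N C m) * (N C m)) < 2 ^ (m * m) → Σ (BiGraph N N) (IsBiRamseyGraph m)
biRamseyGraph-exists N m 2C²<2^m² =
  let R , none = firstMoment-pair (List.replicate N N) count {K = (N C m) * (N C m)} total 2C²<2^m²
  in R , λ c U V m≤∣U∣ m≤∣V∣ hom →
       n≮0 (subst (1 ≤_) (none c) (rectCount-positive c m m R (λ _ _ → refl) m≤∣U∣ m≤∣V∣ hom))
  where
  count : Bool → BiGraph N N → ℕ
  count c R = rectCount c m m R (replicate N true)
  total : ∀ c → sumBits⋆ (List.replicate N N) (count c) * 2 ^ (m * m)
                ≡ (N C m) * (N C m) * 2 ^ sum (List.replicate N N)
  total c = begin
    sumBits⋆ (List.replicate N N) (count c) * 2 ^ (m * m)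
      ≡⟨ sumBits⋆-rectCount N N m m c _ ⟩
    (N C m) * (∣ replicate N true ∣ C m) * 2 ^ (N * N)
      ≡⟨ cong₂ (λ x e → (N C m) * (x C m) * 2 ^ e) (∣replicate-true∣ N) (sym (sum-replicate N N)) ⟩
    (N C m) * (N C m) * 2 ^ sum (List.replicate N N) ∎
    where open ≡-Reasoning

-- Erdős's estimates

C-suc-≤ : ∀ n k → (n C suc k) * suc k ≤ n * (n C k)
C-suc-≤ zero    k       = z≤n
C-suc-≤ (suc n) zero    = ≤-reflexive (trans (*-identityʳ _) (trans (nC1≡n (suc n)) (sym (*-identityʳ _))))
C-suc-≤ (suc n) (suc k) = begin
  (suc n C suc (suc k)) * suc (suc k)
    ≡⟨ cong (_* suc (suc k)) (nCk+nC[k+1]≡[n+1]C[k+1] n (suc k)) ⟨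
  (a + b) * suc (suc k)                       ≡⟨ expand a b k ⟩
  a * suc k + a + b * suc (suc k)             ≤⟨ +-mono-≤ (+-monoˡ-≤ a (C-suc-≤ n k)) (C-suc-≤ n (suc k)) ⟩
  n * (n C k) + a + n * a                     ≤⟨ m≤m+n _ (n C k) ⟩
  n * (n C k) + a + n * a + (n C k)           ≡⟨ collect n (n C k) a ⟩
  suc n * ((n C k) + a)                       ≡⟨ cong (suc n *_) (nCk+nC[k+1]≡[n+1]C[k+1] n k) ⟩
  suc n * (suc n C suc k)                     ∎
  where
  open ≤-Reasoning
  a b : ℕ
  a = n C suc k
  b = n C suc (suc k)
  expand : ∀ a b k → (a + b) * suc (suc k) ≡ a * suc k + a + b * suc (suc k)
  expand = solve-∀
  collect : ∀ n c a → n * c + a + n * a + c ≡ suc n * (c + a)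
  collect = solve-∀

C*!≤^ : ∀ n k → (n C k) * k ! ≤ n ^ k
C*!≤^ n zero    = ≤-refl
C*!≤^ n (suc k) = begin
  (n C suc k) * (suc k * k !)   ≡⟨ *-assoc (n C suc k) (suc k) (k !) ⟨
  (n C suc k) * suc k * k !     ≤⟨ *-monoˡ-≤ (k !) (C-suc-≤ n k) ⟩
  n * (n C k) * k !             ≡⟨ *-assoc n (n C k) (k !) ⟩
  n * ((n C k) * k !)           ≤⟨ *-monoʳ-≤ n (C*!≤^ n k) ⟩
  n * n ^ k                     ∎
  where open ≤-Reasoning

^-distribʳ-* : ∀ a b n → (a * b) ^ n ≡ a ^ n * b ^ n
^-distribʳ-* a b zero    = refl
^-distribʳ-* a b (suc n) = trans (cong (a * b *_) (^-distribʳ-* a b n)) (*-interchange a b (a ^ n) (b ^ n))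

pairs-double : ∀ m → pairs m + pairs m + m ≡ m * m
pairs-double zero    = refl
pairs-double (suc m) = begin
  m + pairs m + (m + pairs m) + suc m        ≡⟨ regroup m (pairs m) ⟩
  suc (m + m + (pairs m + pairs m + m))      ≡⟨ cong (λ x → suc (m + m + x)) (pairs-double m) ⟩
  suc (m + m + m * m)                        ≡⟨ square m ⟩
  suc m * suc m                              ∎
  where
  open ≡-Reasoning
  regroup : ∀ m p → m + p + (m + p) + suc m ≡ suc (m + m + (p + p + m))
  regroup = solve-∀
  square : ∀ m → suc (m + m + m * m) ≡ suc m * suc m
  square = solve-∀

2^[1+m]≤m! : ∀ m → 5 ≤ m → 2 ^ suc m ≤ m !
2^[1+m]≤m! m 5≤m =
  subst (λ k → 2 ^ suc k ≤ k !) (trans (+-comm 5 (m ∸ 5)) (m∸n+n≡m 5≤m)) (from5 (m ∸ 5))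
  where
  from5 : ∀ k → 2 ^ (6 + k) ≤ (5 + k) !
  from5 zero    = toWitness {a? = 2 ^ 6 ≤? 5 !} _
  from5 (suc k) = *-mono-≤ {2} {6 + k} (s≤s (s≤s z≤n)) (from5 k)

square-cancel-< : ∀ {a b} → a * a < b * b → a < b
square-cancel-< {a} {b} a²<b² = ≰⇒> λ b≤a → <⇒≱ a²<b² (*-mono-≤ b≤a b≤a)

C*!-squared-< : ∀ N m → .{{NonZero m}} → N * N < 2 ^ suc m →
                (N C m) * m ! * ((N C m) * m !) < 2 ^ (suc m * m)
C*!-squared-< N m N²<2^[1+m] = begin-strict
  (N C m) * m ! * ((N C m) * m !)  ≤⟨ *-mono-≤ (C*!≤^ N m) (C*!≤^ N m) ⟩
  N ^ m * N ^ m                    ≡⟨ ^-distribʳ-* N N m ⟨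
  (N * N) ^ m                      <⟨ ^-monoˡ-< m N²<2^[1+m] ⟩
  (2 ^ suc m) ^ m                  ≡⟨ ^-*-assoc 2 (suc m) m ⟩
  2 ^ (suc m * m)                  ∎
  where open ≤-Reasoning

erdős-graph : ∀ N m → 5 ≤ m → N * N < 2 ^ suc m → 2 * (N C m) < 2 ^ pairs m
erdős-graph N m 5≤m N²<2^[1+m] = *-cancelˡ-< (2 ^ m) _ _ (begin-strict
  2 ^ m * (2 * c)        ≡⟨ reorder (2 ^ m) c ⟩
  c * 2 ^ suc m          <⟨ square-cancel-< squares ⟩
  2 ^ m * 2 ^ pairs m    ∎)
  where
  open ≤-Reasoning
  instance _ = >-nonZero (≤-trans (s≤s z≤n) 5≤m)
  c : ℕ
  c = N C m
  reorder : ∀ t c → t * (2 * c) ≡ c * (2 * t)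
  reorder = solve-∀
  exponent : suc m * m ≡ (m + pairs m) + (m + pairs m)
  exponent = trans (cong (m +_) (sym (pairs-double m))) (regroup m (pairs m))
    where
    regroup : ∀ m p → m + (p + p + m) ≡ (m + p) + (m + p)
    regroup = solve-∀
  squares : c * 2 ^ suc m * (c * 2 ^ suc m) < 2 ^ m * 2 ^ pairs m * (2 ^ m * 2 ^ pairs m)
  squares = begin-strict
    c * 2 ^ suc m * (c * 2 ^ suc m)        ≤⟨ *-mono-≤ (*-monoʳ-≤ c (2^[1+m]≤m! m 5≤m)) (*-monoʳ-≤ c (2^[1+m]≤m! m 5≤m)) ⟩
    c * m ! * (c * m !)                    <⟨ C*!-squared-< N m N²<2^[1+m] ⟩
    2 ^ (suc m * m)                        ≡⟨ cong (2 ^_) exponent ⟩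
    2 ^ ((m + pairs m) + (m + pairs m))    ≡⟨ ^-distribˡ-+-* 2 (m + pairs m) (m + pairs m) ⟩
    2 ^ (m + pairs m) * 2 ^ (m + pairs m)  ≡⟨ cong (λ x → x * x) (^-distribˡ-+-* 2 m (pairs m)) ⟩
    2 ^ m * 2 ^ pairs m * (2 ^ m * 2 ^ pairs m) ∎

erdős-bipartite : ∀ N m → 5 ≤ m → N * N < 2 ^ suc m → 2 * ((N C m) * (N C m)) < 2 ^ (m * m)
erdős-bipartite N m 5≤m N²<2^[1+m] = *-cancelˡ-< (2 ^ m) _ _ (begin-strict
  2 ^ m * (2 * (c * c))                 ≡⟨ reorder (2 ^ m) c ⟩
  c * c * 2 ^ suc m                     ≤⟨ *-monoʳ-≤ (c * c) (≤-trans (2^[1+m]≤m! m 5≤m) (m≤m*n (m !) (m !) {{m !≢0}})) ⟩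
  c * c * (m ! * m !)                   ≡⟨ *-interchange c c (m !) (m !) ⟩
  c * m ! * (c * m !)                   <⟨ C*!-squared-< N m N²<2^[1+m] ⟩
  2 ^ (suc m * m)                       ≡⟨ ^-distribˡ-+-* 2 m (m * m) ⟩
  2 ^ m * 2 ^ (m * m)                   ∎)
  where
  open ≤-Reasoning
  instance _ = >-nonZero (≤-trans (s≤s z≤n) 5≤m)
  c : ℕ
  c = N C m
  reorder : ∀ t c → t * (2 * (c * c)) ≡ c * c * (2 * t)
  reorder = solve-∀

-- The generalised pigeonhole principle

∑-mono-≤ : ∀ {n} {f g : Vector ℕ n} → (∀ i → f i ≤ g i) → ∑[ i < n ] f i ≤ ∑[ i < n ] g i
∑-mono-≤ {zero}  f≤g = z≤n
∑-mono-≤ {suc n} f≤g = +-mono-≤ (f≤g zero) (∑-mono-≤ (f≤g ∘ suc))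

∑-ones : ∀ n → ∑[ i < n ] 1 ≡ n
∑-ones zero    = refl
∑-ones (suc n) = cong suc (∑-ones n)

zero∷suc∘-injective : ∀ {t s} {g : Fin t → Fin s} → Injective _≡_ _≡_ g →
                      Injective _≡_ _≡_ (zero ∷ suc ∘ g)
zero∷suc∘-injective g-inj {zero}  {zero}  _  = refl
zero∷suc∘-injective g-inj {suc i} {suc j} eq = cong suc (g-inj (Finₚ.suc-injective eq))

choose : ∀ t {s} (W : Bits s) → t ≤ ∣ W ∣ →
         Σ (Fin t → Fin s) λ g → Injective _≡_ _≡_ g × (∀ j → W (g j) ≡ true)
choose zero    W _ = (λ ()) , (λ { {()} }) , (λ ())
choose (suc t) {suc s} W t≤∣W∣ with head W in W₀
... | true  = let g , g-inj , g∈W = choose t (tail W) (≤-pred t≤∣W∣)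
              in (zero ∷ suc ∘ g) , zero∷suc∘-injective g-inj , λ { zero → W₀ ; (suc j) → g∈W j }
... | false = let g , g-inj , g∈W = choose (suc t) (tail W) t≤∣W∣
              in suc ∘ g , g-inj ∘ Finₚ.suc-injective , g∈W

≟-sound : ∀ {n} {x y : Fin n} → does (x ≟ y) ≡ true → x ≡ y
≟-sound {x = x} {y} eq with x ≟ y | eq
... | yes x≡y | _ = x≡y
... | no  _   | ()

∑-indicator : ∀ {n} (x : Fin n) → ∑[ a < n ] bit (does (x ≟ a)) ≡ 1
∑-indicator {suc n} zero    = cong suc (sum-replicate-zero n)
∑-indicator {suc n} (suc x) = ∑-indicator x

multiplicity : ∀ {s N} → (Fin s → Fin N) → Fin N → ℕ
multiplicity ans a = ∣ (λ i → does (ans i ≟ a)) ∣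

occupied : ∀ {s N} → (Fin s → Fin N) → Bits N
occupied ans a = not (multiplicity ans a ≡ᵇ 0)

∑-multiplicity : ∀ {s N} (ans : Fin s → Fin N) → ∑[ a < N ] multiplicity ans a ≡ s
∑-multiplicity {s} {N} ans = begin
  ∑[ a < N ] ∑[ i < s ] bit (does (ans i ≟ a))  ≡⟨ ∑-comm (λ a i → bit (does (ans i ≟ a))) ⟩
  ∑[ i < s ] ∑[ a < N ] bit (does (ans i ≟ a))  ≡⟨ sum-cong-≗ (λ i → ∑-indicator (ans i)) ⟩
  ∑[ i < s ] 1                                  ≡⟨ ∑-ones s ⟩
  s                                             ∎
  where open ≡-Reasoning

occupied-witness : ∀ {s N} (ans : Fin s → Fin N) {a} → occupied ans a ≡ true → ∃ λ i → ans i ≡ a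
occupied-witness ans {a} occ with multiplicity ans a in eq
... | zero with () ← occ
... | suc _ = let g , _ , g↦a = choose 1 _ (subst (1 ≤_) (sym eq) (s≤s z≤n)) in g zero , ≟-sound (g↦a zero)

ManyHoles : ∀ t s {N} → (Fin s → Fin N) → Set
ManyHoles t s {N} holes =
  Σ (Bits N) λ H → s ≤ pred t * ∣ H ∣ × (∀ a → H a ≡ true → ∃ λ i → holes i ≡ a)

findCollision : ∀ t {s N} (ans : Fin s → Fin N) → (∃ λ g → IsCollision t s N ans g) ⊎ ManyHoles t s ans
findCollision t {s} {N} ans with any? (λ a → t ≤? multiplicity ans a)
... | yes (a , t≤mult) =
  let g , g-inj , g↦a = choose t _ t≤mult
  in inj₁ (g , g-inj , λ i j → trans (≟-sound (g↦a i)) (sym (≟-sound (g↦a j))))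
... | no ¬heavy = inj₂ (occupied ans , spread , λ a → occupied-witness ans)
  where
  open ≤-Reasoning
  light : ∀ a → multiplicity ans a ≤ pred t * bit (occupied ans a)
  light a with multiplicity ans a in eq
  ... | zero  = z≤n
  ... | suc k = subst (suc k ≤_) (sym (*-identityʳ (pred t)))
                      (<⇒≤pred (≰⇒> λ t≤ → ¬heavy (a , subst (t ≤_) (sym eq) t≤)))
  spread : s ≤ pred t * ∣ occupied ans ∣
  spread = begin
    s                                          ≡⟨ ∑-multiplicity ans ⟨
    ∑[ a < N ] multiplicity ans a                ≤⟨ ∑-mono-≤ light ⟩
    ∑[ a < N ] (pred t * bit (occupied ans a))   ≡⟨ *-distribˡ-sum (pred t) (bit ∘ occupied ans) ⟨
    pred t * ∣ occupied ans ∣                  ∎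

maxF-lub : ∀ n {f : Fin n → ℕ} {d} → (∀ j → f j ≤ d) → maxF n f ≤ d
maxF-lub zero    f≤d = z≤n
maxF-lub (suc n) f≤d = ⊔-lub (f≤d zero) (maxF-lub n (f≤d ∘ suc))

depth-query : ∀ {M N A} (x : Fin M) (k : Fin N → DT M N A) {d} →
              (∀ a → depth (k a) ≤ d) → depth (query x k) ≤ suc d
depth-query {N = N} x k k≤d = s≤s (maxF-lub N k≤d)

depth-query₂ : ∀ {M N A} (x y : Fin M) (f : Fin N → Fin N → A) →
               depth (query x λ a → query y λ b → leaf (f a b)) ≤ 2
depth-query₂ {N = N} x y f = s≤s (maxF-lub N λ a → s≤s (maxF-lub N λ b → z≤n))

queryAll : ∀ {M N A s} → (Fin s → Fin M) → ((Fin s → Fin N) → DT M N A) → DT M N A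
queryAll {s = zero}  P k = k Vector.[]
queryAll {s = suc s} P k = query (head P) λ a → queryAll (tail P) (k ∘ (a ∷_))

eval-queryAll : ∀ {M N A s} (P : Fin s → Fin M) (k : (Fin s → Fin N) → DT M N A) h →
                ∃ λ ans → (∀ i → ans i ≡ h (P i)) × eval (queryAll P k) h ≡ eval (k ans) h
eval-queryAll {s = zero}  P k h = Vector.[] , (λ ()) , refl
eval-queryAll {s = suc s} P k h =
  let ans , ans≗hP , eval≡ = eval-queryAll (tail P) (k ∘ (h (head P) ∷_)) h
  in (h (head P) ∷ ans) , (λ { zero → refl ; (suc i) → ans≗hP i }) , eval≡

depth-queryAll : ∀ {M N A s} (P : Fin s → Fin M) (k : (Fin s → Fin N) → DT M N A) {d} →
                 (∀ ans → depth (k ans) ≤ d) → depth (queryAll P k) ≤ s + d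
depth-queryAll {s = zero}  P k k≤d = k≤d _
depth-queryAll {s = suc s} P k k≤d = depth-query (head P) _ (λ a → depth-queryAll (tail P) _ (k≤d ∘ _))

respond : ∀ {t s M N} → (Fin s → Fin M) → DT M N (Fin t → Fin M) → (Fin s → Fin N) → DT M N (Fin t → Fin M)
respond {t} P fallback ans with findCollision t ans
... | inj₁ (g , _) = leaf (P ∘ g)
... | inj₂ _       = fallback

searchCollision : ∀ {t s M N} → (Fin s → Fin M) → DT M N (Fin t → Fin M) → DT M N (Fin t → Fin M)
searchCollision P fallback = queryAll P (respond P fallback)

depth-searchCollision : ∀ {t s M N} (P : Fin s → Fin M) (fallback : DT M N (Fin t → Fin M)) →
                        depth (searchCollision P fallback) ≤ s + depth fallback
depth-searchCollision {t} P fallback = depth-queryAll P _ bound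
  where
  bound : ∀ ans → depth (respond P fallback ans) ≤ depth fallback
  bound ans with findCollision t ans
  ... | inj₁ _ = z≤n
  ... | inj₂ _ = ≤-refl

searchCollision-correct :
  ∀ {t s M N} {P : Fin s → Fin M} → Injective _≡_ _≡_ P → (fallback : DT M N (Fin t → Fin M)) →
  ∀ h → IsCollision t M N h (eval (searchCollision P fallback) h)
        ⊎ (ManyHoles t s (h ∘ P) × eval (searchCollision P fallback) h ≡ eval fallback h)
searchCollision-correct {t} {s} {M} {N} {P} P-inj fallback h =
  let ans , ans≗hP , eval≡ = eval-queryAll P (respond P fallback) h
  in subst (λ out → IsCollision t M N h out ⊎ (ManyHoles t s (h ∘ P) × out ≡ eval fallback h))
           (sym eval≡) (outcome ans ans≗hP)
  where
  outcome : ∀ ans → (∀ i → ans i ≡ h (P i)) →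
            IsCollision t M N h (eval (respond P fallback ans) h)
            ⊎ (ManyHoles t s (h ∘ P) × eval (respond P fallback ans) h ≡ eval fallback h)
  outcome ans ans≗hP with findCollision t ans
  ... | inj₁ (g , g-inj , same) =
    inj₁ (g-inj ∘ P-inj , λ i j → trans (sym (ans≗hP (g i))) (trans (same i j) (ans≗hP (g j))))
  ... | inj₂ (H , spread , witness) =
    inj₂ ((H , spread , λ a Hₐ → let i , ansᵢ≡a = witness a Hₐ in i , trans (sym (ans≗hP i)) ansᵢ≡a) , refl)

-- The reductions

embed : ∀ k {M} → 2 ^ k ≤ M → Vtx k → Fin M
embed k 2^k≤M u = inject≤ u 2^k≤M

embed-injective : ∀ k {M} (2^k≤M : 2 ^ k ≤ M) → Injective _≡_ _≡_ (embed k 2^k≤M)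
embed-injective k 2^k≤M {u} {v} = Finₚ.inject≤-injective 2^k≤M 2^k≤M u v

somePigeon : ∀ k {M} → 2 ^ k ≤ M → Fin M
somePigeon k 2^k≤M = fromℕ< (≤-trans (m^n>0 2 k) 2^k≤M)

many-holes : ∀ t m {s x} → pred t * pred m < s → s ≤ pred t * x → m ≤ x
many-holes t m {x = x} tm<s s≤tx = ≮⇒≥ λ x<m →
  <⇒≱ (≤-trans tm<s s≤tx) (*-monoʳ-≤ (pred t) (<⇒≤pred x<m))

2≤k : ∀ {k a} → a < k / 2 → 2 ≤ k
2≤k {suc (suc k)} _ = s≤s (s≤s z≤n)

holes-homogeneous : ∀ {s N c} {G : Graph N} (holes : Fin s → Fin N) →
                    (∀ i j → i ≢ j → adj G (holes i) (holes j) ≡ c) →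
                    ∀ H → (∀ a → H a ≡ true → ∃ λ i → holes i ≡ a) → IsHomogeneous c G H
holes-homogeneous holes hom H witness a b a≢b Hₐ H_b with witness a Hₐ | witness b H_b
... | i , refl | j , refl = hom i j λ { refl → a≢b refl }

graphReduction : ∀ {c t M N m} (G : Graph N) → IsRamseyGraph m G → ∀ k → 2 ^ k ≤ M →
                 pred t * pred m < k / 2 → k * ⌈log₂ N ⌉ + 2 * k ≤ polylogBound c M N →
                 RamseyRed c t M N
graphReduction {c} {t} {M} {N} {m} G ramsey k 2^k≤M tm<s cost = record
  { k = k ; d = k ; inst = inst ; back = back
  ; inst-depth = λ u v → ≤-trans (depth-query₂ (emb u) (emb v) (adj G)) (2≤k tm<s)
  ; back-depth = back-depth ; correct = correct ; cost = cost }
  where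
  emb : Vtx k → Fin M
  emb = embed k 2^k≤M
  inst : Vtx k → Vtx k → DT M N Bool
  inst u v = query (emb u) λ a → query (emb v) λ b → leaf (adj G a b)
  -- returned only on target solutions that cannot be valid
  junk : DT M N (Fin t → Fin M)
  junk = leaf λ _ → somePigeon k 2^k≤M
  back : RSol k → DT M N (Fin t → Fin M)
  back (loop _)   = junk
  back (asym _ _) = junk
  back (homog S)  = searchCollision (emb ∘ S) junk
  back-depth : ∀ sol → depth (back sol) ≤ k
  back-depth (loop _)   = z≤n
  back-depth (asym _ _) = z≤n
  back-depth (homog S)  = ≤-trans (depth-searchCollision (emb ∘ S) junk) (≤-trans (≤-reflexive (+-identityʳ _)) (m/n≤m k 2))
  correct : ∀ h sol → RValid k (λ u v → eval (inst u v) h) sol → IsCollision t M N h (eval (back sol) h)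
  correct h (loop u)   loop-edge = contradiction (trans (sym loop-edge) (adj-irrefl G _)) λ ()
  correct h (asym u v) asymmetric = contradiction (adj-sym G _ _) asymmetric
  correct h (homog S) (S-inj , hom) with searchCollision-correct (S-inj ∘ embed-injective k 2^k≤M) junk h
  ... | inj₁ collision = collision
  ... | inj₂ ((H , spread , witness) , _) = ⊥-elim ([ impossible true , impossible false ]′ hom)
    where
    impossible : ∀ colour → (∀ i j → i ≢ j → adj G (h (emb (S i))) (h (emb (S j))) ≡ colour) → ⊥
    impossible colour hom-colour =
      ramsey colour H (many-holes t m tm<s spread) (holes-homogeneous (h ∘ emb ∘ S) hom-colour H witness)

holes-homogeneousRect : ∀ {s N c} {R : BiGraph N N} (holesU holesV : Fin s → Fin N) →
                        (∀ i j → row R (holesU i) (holesV j) ≡ c) →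
                        ∀ HU HV → (∀ a → HU a ≡ true → ∃ λ i → holesU i ≡ a) →
                        (∀ b → HV b ≡ true → ∃ λ j → holesV j ≡ b) → IsHomogeneousRect c R HU HV
holes-homogeneousRect holesU holesV hom HU HV witnessU witnessV a b HUₐ HV_b
  with witnessU a HUₐ | witnessV b HV_b
... | i , refl | j , refl = hom i j

biGraphReduction : ∀ {c t M N m} (R : BiGraph N N) → IsBiRamseyGraph m R → ∀ k → 2 ^ k ≤ M →
                   pred t * pred m < k / 2 → k * ⌈log₂ N ⌉ + 2 * k ≤ polylogBound c M N →
                   BiRamseyRed c t M N
biGraphReduction {c} {t} {M} {N} {m} R biRamsey k 2^k≤M tm<s cost = record
  { k = k ; d = k ; inst = inst ; back = back
  ; inst-depth = λ u v → ≤-trans (depth-query₂ (emb u) (emb v) (row R)) (2≤k tm<s)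
  ; back-depth = back-depth ; correct = correct ; cost = cost }
  where
  emb : Vtx k → Fin M
  emb = embed k 2^k≤M
  inst : Vtx k → Vtx k → DT M N Bool
  inst u v = query (emb u) λ a → query (emb v) λ b → leaf (row R a b)
  junk : DT M N (Fin t → Fin M)
  junk = leaf λ _ → somePigeon k 2^k≤M
  back : BSol k → DT M N (Fin t → Fin M)
  back (bsol U V) = searchCollision (emb ∘ U) (searchCollision (emb ∘ V) junk)
  back-depth : ∀ sol → depth (back sol) ≤ k
  back-depth (bsol U V) = begin
    depth (back (bsol U V))      ≤⟨ depth-searchCollision (emb ∘ U) _ ⟩
    k / 2 + depth (searchCollision (emb ∘ V) junk) ≤⟨ +-monoʳ-≤ (k / 2) (depth-searchCollision (emb ∘ V) junk) ⟩
    k / 2 + (k / 2 + 0)          ≡⟨ *-comm 2 (k / 2) ⟩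
    k / 2 * 2                    ≤⟨ m/n*n≤m k 2 ⟩
    k                            ∎
    where open ≤-Reasoning
  correct : ∀ h sol → BValid k (λ u v → eval (inst u v) h) sol → IsCollision t M N h (eval (back sol) h)
  correct h (bsol U V) (U-inj , V-inj , hom)
    with searchCollision-correct (U-inj ∘ embed-injective k 2^k≤M) (searchCollision (emb ∘ V) junk) h
  ... | inj₁ collision = collision
  ... | inj₂ ((HU , spreadU , witnessU) , fallsThrough)
    with searchCollision-correct (V-inj ∘ embed-injective k 2^k≤M) junk h
  ... | inj₁ collision = subst (IsCollision t M N h) (sym fallsThrough) collision
  ... | inj₂ ((HV , spreadV , witnessV) , _) = ⊥-elim ([ impossible true , impossible false ]′ hom)
    where
    impossible : ∀ colour → (∀ i j → row R (h (emb (U i))) (h (emb (V j))) ≡ colour) → ⊥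
    impossible colour hom-colour =
      biRamsey colour HU HV (many-holes t m tm<s spreadU) (many-holes t m tm<s spreadV)
               (holes-homogeneousRect (h ∘ emb ∘ U) (h ∘ emb ∘ V) hom-colour HU HV witnessU witnessV)

record DirectSolver (t M N d : ℕ) : Set where
  field
    tree   : DT M N (Fin t → Fin M)
    depth≤ : depth tree ≤ d
    solves : ∀ h → IsCollision t M N h (eval tree h)

module _ {c t M N d} (solver : DirectSolver t M N d) (cost : d * ⌈log₂ N ⌉ ≤ polylogBound c M N) where
  open DirectSolver solver

  directRamseyRed : RamseyRed c t M N
  directRamseyRed = record
    { k = 0 ; d = d ; inst = λ _ _ → leaf false ; back = λ _ → tree
    ; inst-depth = λ _ _ → z≤n ; back-depth = λ _ → depth≤ ; correct = λ h _ _ → solves h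
    ; cost = subst (_≤ polylogBound c M N) (sym (+-identityʳ _)) cost }

  directBiRamseyRed : BiRamseyRed c t M N
  directBiRamseyRed = record
    { k = 0 ; d = d ; inst = λ _ _ → leaf false ; back = λ _ → tree
    ; inst-depth = λ _ _ → z≤n ; back-depth = λ _ → depth≤ ; correct = λ h _ _ → solves h
    ; cost = subst (_≤ polylogBound c M N) (sym (+-identityʳ _)) cost }

trivialSolver : ∀ {t M N} → t ≤ 1 → t ≤ M → DirectSolver t M N 0
trivialSolver {t} {M} {N} t≤1 t≤M = record
  { tree = leaf pigeons ; depth≤ = z≤n
  ; solves = λ h → (λ {i} {j} → Finₚ.inject≤-injective t≤M t≤M i j) , λ i j → cong (h ∘ pigeons) (unique t≤1 i j) }
  where
  pigeons : Fin t → Fin M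
  pigeons i = inject≤ i t≤M
  unique : ∀ {t} → t ≤ 1 → (i j : Fin t) → i ≡ j
  unique (s≤s z≤n) zero zero = refl

bruteForceSolver : ∀ {t' M N} → suc (t' * N) ≤ M → DirectSolver (suc t') M N (suc (t' * N))
bruteForceSolver {t'} {M} {N} s≤M = record
  { tree = searchCollision pigeons junk
  ; depth≤ = ≤-trans (depth-searchCollision pigeons junk) (≤-reflexive (+-identityʳ _))
  ; solves = solves }
  where
  pigeons : Fin (suc (t' * N)) → Fin M
  pigeons i = inject≤ i s≤M
  junk : DT M N (Fin (suc t') → Fin M)
  junk = leaf λ _ → pigeons zero
  solves : ∀ h → IsCollision (suc t') M N h (eval (searchCollision pigeons junk) h)
  solves h with searchCollision-correct (λ {i} {j} → Finₚ.inject≤-injective s≤M s≤M i j) junk h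
  ... | inj₁ collision = collision
  ... | inj₂ ((H , spread , _) , _) = ⊥-elim (<⇒≱ (s≤s ≤-refl) (≤-trans spread (*-monoʳ-≤ t' (∣∣≤n H))))

logSrc : ℕ → ℕ → ℕ
logSrc M N = ⌈log₂ srcLen M N ⌉

-- The factor 15 absorbs the brute-force regime: at most 5t queries of at most 3 bits each.
budget : ℕ → ℕ → ℕ
budget M N = 15 * suc (logSrc M N) ^ 2

budget≤polylogBound : ∀ M N → budget M N ≤ polylogBound 15 M N
budget≤polylogBound M N = *-monoʳ-≤ 15 (^-monoʳ-≤ (suc (logSrc M N)) {2} {15} (s≤s (s≤s z≤n)))

⌈log₂⌉-≤ : ∀ {n a} → n ≤ 2 ^ a → ⌈log₂ n ⌉ ≤ a
⌈log₂⌉-≤ {n} {a} n≤2^a = subst (⌈log₂ n ⌉ ≤_) (⌈log₂2^n⌉≡n a) (⌈log₂⌉-mono-≤ n≤2^a)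

≥-⌈log₂⌉ : ∀ {n a} → 2 ^ a ≤ n → a ≤ ⌈log₂ n ⌉
≥-⌈log₂⌉ {n} {a} 2^a≤n = subst (_≤ ⌈log₂ n ⌉) (⌈log₂2^n⌉≡n a) (⌈log₂⌉-mono-≤ 2^a≤n)

≤-logSrc : ∀ {a M N} → 2 ≤ N → 2 ^ a ≤ M → a ≤ logSrc M N
≤-logSrc {a} {M} {N} 2≤N 2^a≤M = ≥-⌈log₂⌉ (≤-trans 2^a≤M (m≤m*n M ⌈log₂ N ⌉))
  where instance _ = >-nonZero (⌈log₂⌉-mono-≤ 2≤N)

log-bracket : ∀ n → 1 ≤ n → ∃ λ m → 2 ^ m ≤ n × n < 2 ^ suc m
log-bracket (suc zero)    _ = 0 , ≤-refl , s≤s (s≤s z≤n)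
log-bracket (suc (suc n)) _ with log-bracket (suc n) (s≤s z≤n)
... | m , lower , upper with suc (suc n) <? 2 ^ suc m
...   | yes below = m , ≤-trans lower (n≤1+n _) , below
...   | no  ¬below = suc m , ≮⇒≥ ¬below , (begin-strict
  suc (suc n)           ≤⟨ upper ⟩
  2 ^ suc m             <⟨ m<m+n (2 ^ suc m) (m^n>0 2 (suc m)) ⟩
  2 ^ suc m + 2 ^ suc m ≡⟨ cong (2 ^ suc m +_) (+-identityʳ _) ⟨
  2 ^ suc (suc m)       ∎)
  where open ≤-Reasoning

pigeons-from-params : ∀ {t M N} m a → 2 ^ m ≤ N * N → N ^ (4 * t) ≤ 4 ^ t * M →
                      a + 2 * t ≤ 2 * (m * t) → 2 ^ a ≤ M
pigeons-from-params {t} {M} {N} m a 2^m≤N² params exponents = *-cancelˡ-≤ (2 ^ (2 * t)) (begin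
  2 ^ (2 * t) * 2 ^ a    ≡⟨ ^-distribˡ-+-* 2 (2 * t) a ⟨
  2 ^ (2 * t + a)        ≤⟨ ^-monoʳ-≤ 2 (≤-trans (≤-reflexive (+-comm (2 * t) a)) exponents) ⟩
  2 ^ (2 * (m * t))      ≡⟨ cong (2 ^_) (rearrange m t) ⟩
  2 ^ (m * (2 * t))      ≡⟨ ^-*-assoc 2 m (2 * t) ⟨
  (2 ^ m) ^ (2 * t)      ≤⟨ ^-monoˡ-≤ (2 * t) 2^m≤N² ⟩
  (N * N) ^ (2 * t)      ≡⟨ ^-distribʳ-* N N (2 * t) ⟩
  N ^ (2 * t) * N ^ (2 * t) ≡⟨ ^-distribˡ-+-* N (2 * t) (2 * t) ⟨
  N ^ (2 * t + 2 * t)    ≡⟨ cong (N ^_) (double t) ⟩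
  N ^ (4 * t)            ≤⟨ params ⟩
  4 ^ t * M              ≡⟨ cong (_* M) (^-*-assoc 2 2 t) ⟩
  2 ^ (2 * t) * M        ∎)
  where
  open ≤-Reasoning
  instance _ = m^n≢0 2 (2 * t)
  rearrange : ∀ m t → 2 * (m * t) ≡ m * (2 * t)
  rearrange = solve-∀
  double : ∀ t → 2 * t + 2 * t ≡ 4 * t
  double = solve-∀

pigeons-available : ∀ t' {M N} → suc t' * N < M + N → suc (t' * N) ≤ M
pigeons-available t' {M} {N} tN<M+N = +-cancelʳ-< N (t' * N) M (subst (_< M + N) (+-comm N (t' * N)) tN<M+N)

bruteForce-cost : ∀ t' M N → N ≤ 5 → N ^ (4 * suc t') ≤ 4 ^ suc t' * M →
                  suc (t' * N) * ⌈log₂ N ⌉ ≤ budget M N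
bruteForce-cost t' M N N≤5 params with 2 ≤? N
... | no  N≱2 = ≤-trans (≤-reflexive (trans (cong (suc (t' * N) *_) L≡0) (*-zeroʳ (suc (t' * N))))) z≤n
  where
  L≡0 : ⌈log₂ N ⌉ ≡ 0
  L≡0 = n≤0⇒n≡0 (⌈log₂⌉-≤ {a = 0} (≤-pred (≰⇒> N≱2)))
... | yes 2≤N = begin
  suc (t' * N) * ⌈log₂ N ⌉  ≤⟨ *-mono-≤ (s≤s (*-monoʳ-≤ t' N≤5)) (⌈log₂⌉-≤ {a = 3} (≤-trans N≤5 (toWitness {a? = 5 ≤? 8} _))) ⟩
  suc (t' * 5) * 3          ≤⟨ m≤m+n _ 12 ⟩
  suc (t' * 5) * 3 + 12     ≡⟨ arith t' ⟩
  15 * suc t'               ≤⟨ *-monoʳ-≤ 15 (≤-trans (m≤m+n (suc t') _) (≤-logSrc 2≤N 2^[2t]≤M)) ⟩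
  15 * Y                    ≤⟨ *-monoʳ-≤ 15 (≤-trans (n≤1+n Y) (m≤m*n (suc Y) (suc Y * 1))) ⟩
  15 * suc Y ^ 2            ∎
  where
  open ≤-Reasoning
  Y : ℕ
  Y = logSrc M N
  arith : ∀ t' → suc (t' * 5) * 3 + 12 ≡ 15 * suc t'
  arith = solve-∀
  double : ∀ t → 2 * t + 2 * t ≡ 2 * (2 * t)
  double = solve-∀
  2^[2t]≤M : 2 ^ (2 * suc t') ≤ M
  2^[2t]≤M = pigeons-from-params {suc t'} {M} {N} 2 (2 * suc t') (*-mono-≤ 2≤N 2≤N) params (≤-reflexive (double (suc t')))

record LargeRegime (t M N : ℕ) : Set where
  field
    m k          : ℕ
    5≤m          : 5 ≤ m
    N²<2^[1+m]   : N * N < 2 ^ suc m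
    2^k≤M        : 2 ^ k ≤ M
    clique-bound : pred t * pred m < k / 2
    cost         : k * ⌈log₂ N ⌉ + 2 * k ≤ budget M N

-- m = ⌊log₂ N²⌋ is the size of the forbidden homogeneous sets and s = (t − 1)(m − 1) + 1 the
-- number of pigeons in a target solution; the target has 2 ^ (2 * s) vertices.
largeRegime : ∀ t' {M N} → 1 ≤ t' → PigeonParams (suc t') M N → 6 ≤ N → LargeRegime (suc t') M N
largeRegime t' {M} {N} 1≤t' (params , _) 6≤N
  with log-bracket (N * N) (*-mono-≤ {1} {N} (≤-trans (s≤s z≤n) 6≤N) (≤-trans (s≤s z≤n) 6≤N))
... | m , 2^m≤N² , N²<2^[1+m] = record
  { m = m ; k = k ; 5≤m = 5≤m ; N²<2^[1+m] = N²<2^[1+m] ; 2^k≤M = 2^k≤M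
  ; clique-bound = subst (t' * pred m <_) (sym k/2≡s) ≤-refl
  ; cost = begin
      k * ⌈log₂ N ⌉ + 2 * k  ≤⟨ +-mono-≤ (*-mono-≤ k≤Y (≤-trans L≤k k≤Y)) (*-monoʳ-≤ 2 k≤Y) ⟩
      Y * Y + 2 * Y          ≤⟨ m≤m+n _ (14 * (Y * Y) + 28 * Y + 15) ⟩
      Y * Y + 2 * Y + (14 * (Y * Y) + 28 * Y + 15) ≡⟨ square Y ⟩
      15 * suc Y ^ 2         ∎ }
  where
  open ≤-Reasoning
  Y : ℕ
  Y = logSrc M N
  2≤N : 2 ≤ N
  2≤N = ≤-trans (s≤s (s≤s z≤n)) 6≤N
  5≤m : 5 ≤ m
  5≤m = ≮⇒≥ λ m<5 → <⇒≱ N²<2^[1+m]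
          (≤-trans (^-monoʳ-≤ 2 m<5) (≤-trans (toWitness {a? = 2 ^ 5 ≤? 6 * 6} _) (*-mono-≤ 6≤N 6≤N)))
  s k : ℕ
  s = suc (t' * pred m)
  k = 2 * s
  k/2≡s : k / 2 ≡ s
  k/2≡s = trans (cong (_/ 2) (*-comm 2 s)) (m*n/n≡m s 2)
  exponents : ∀ m → 2 ≤ m → 2 * suc (t' * pred m) + 2 * suc t' ≤ 2 * (m * suc t')
  exponents (suc zero)      (s≤s ())
  exponents (suc (suc m'')) _ =
    subst (2 * suc (t' * suc m'') + 2 * suc t' ≤_) (arith t' m'') (m≤m+n _ (2 * m''))
    where
    arith : ∀ t' m'' → 2 * suc (t' * suc m'') + 2 * suc t' + 2 * m'' ≡ 2 * (suc (suc m'') * suc t')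
    arith = solve-∀
  2^k≤M : 2 ^ k ≤ M
  2^k≤M = pigeons-from-params {suc t'} {M} {N} m k 2^m≤N² params (exponents m (≤-trans (s≤s (s≤s z≤n)) 5≤m))
  k≤Y : k ≤ Y
  k≤Y = ≤-logSrc 2≤N 2^k≤M
  N≤2^m : N ≤ 2 ^ m
  N≤2^m = <⇒≤ (*-cancelˡ-< 2 N (2 ^ m) (≤-trans (s≤s (*-monoˡ-≤ N 2≤N)) N²<2^[1+m]))
  L≤k : ⌈log₂ N ⌉ ≤ k
  L≤k = begin
    ⌈log₂ N ⌉        ≤⟨ ⌈log₂⌉-≤ N≤2^m ⟩
    m                ≡⟨ suc-pred m {{>-nonZero (≤-trans (s≤s z≤n) 5≤m)}} ⟨
    suc (pred m)     ≤⟨ s≤s (m≤n*m (pred m) t' {{>-nonZero 1≤t'}}) ⟩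
    s                ≤⟨ m≤m+n s (s + 0) ⟩
    k                ∎
  square : ∀ y → y * y + 2 * y + (14 * (y * y) + 28 * y + 15) ≡ 15 * ((1 + y) * ((1 + y) * 1))
  square = solve-∀

data Regime (t M N : ℕ) : Set where
  direct : ∀ {d} → DirectSolver t M N d → d * ⌈log₂ N ⌉ ≤ budget M N → Regime t M N
  large  : LargeRegime t M N → Regime t M N

regime : ∀ t M N → PigeonParams t M N → Regime t M N
regime zero             M N _           = direct (trivialSolver z≤n z≤n) z≤n
regime (suc zero)       M N (_ , N<M+N) = direct (trivialSolver ≤-refl (pigeons-available 0 N<M+N)) z≤n
regime (suc t'@(suc _)) M N params@(powers , N<M+N) with N ≤? 5
... | yes N≤5 = direct (bruteForceSolver (pigeons-available t' N<M+N)) (bruteForce-cost t' M N N≤5 powers)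
... | no  N≰5 = large (largeRegime t' (s≤s z≤n) params (≰⇒> N≰5))

ramseyReduction : ∀ {t M N} → Regime t M N → RamseyRed 15 t M N
ramseyReduction {M = M} {N} (direct solver cost) = directRamseyRed solver (≤-trans cost (budget≤polylogBound M N))
ramseyReduction {M = M} {N} (large p) =
  let G , ramsey = ramseyGraph-exists N m (erdős-graph N m 5≤m N²<2^[1+m])
  in graphReduction G ramsey k 2^k≤M clique-bound (≤-trans cost (budget≤polylogBound M N))
  where open LargeRegime p

biRamseyReduction : ∀ {t M N} → Regime t M N → BiRamseyRed 15 t M N
biRamseyReduction {M = M} {N} (direct solver cost) = directBiRamseyRed solver (≤-trans cost (budget≤polylogBound M N))
biRamseyReduction {M = M} {N} (large p) =
  let R , biRamsey = biRamseyGraph-exists N m (erdős-bipartite N m 5≤m N²<2^[1+m])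
  in biGraphReduction R biRamsey k 2^k≤M clique-bound (≤-trans cost (budget≤polylogBound M N))
  where open LargeRegime p

mainTheorem2 :
    (Σ ℕ λ c → ∀ t M N → PigeonParams t M N → RamseyRed c t M N) ×
    (Σ ℕ λ c → ∀ t M N → PigeonParams t M N → BiRamseyRed c t M N)
mainTheorem2 = (15 , λ t M N → ramseyReduction ∘′ regime t M N)
             , (15 , λ t M N → biRamseyReduction ∘′ regime t M N)
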